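{- For a positive integer $L$, let $B(L,1)$ be the quaternion algebra over $\mathbf{Q}$ (isomorphic to $M_2(\mathbf{Q})$) with basis $1,i^L,j^L,k^L$, where $(i^L)^2=-L$, $(j^L)^2=1$, $k^L=i^Lj^L=-j^Li^L$, and let $R(L)=\mathbf{Z}e_1^L+\mathbf{Z}e_2^L+\mathbf{Z}e_3^L+\mathbf{Z}e_4^L$ with $e_1^L=1$, $e_2^L=\frac{1+j^L}{2}$, $e_3^L=\frac{i^L+k^L}{2}$, $e_4^L=Lj^L+k^L$. For positive integers $N,M$ let $\Psi_N^M:B(N,1)\to B(M,1)$ be the $\mathbf{Q}$-linear map with $\Psi_N^M(1)=1$, $\Psi_N^M(j^N)=j^M$, $$\Psi_N^M(i^N)=\tfrac{M+N}{2M}\,i^M+\tfrac{M-N}{2M}\,k^M,\qquad \Psi_N^M(k^N)=\tfrac{M-N}{2M}\,i^M+\tfrac{M+N}{2M}\,k^M$$ (an isomorphism of $\mathbf{Q}$-algebras). If $M\mid N$, then $\Psi_N^M(R(N))\subset R(M)$.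
   Context: $R(L)$ is an Eichler order of level $L$ in $B(L,1)$; $\Psi_N^M$ is the composite $(\varphi^M)^{ -1}\circ\varphi^N$ where $\varphi^L:B(L,1)\to M_2(\mathbf{Q})$ sends $i^L\mapsto\begin{pmatrix}0&-1\\L&0\end{pmatrix}$, $j^L\mapsto\begin{pmatrix}-1&0\\0&1\end{pmatrix}$. -}

module Defs where

open import Data.Nat as ℕ using (ℕ; NonZero)
open import Data.Integer as ℤ using (ℤ; +_)
open import Data.Rational using (ℚ; 0ℚ; 1ℚ; ½; _+_; _*_; -_; _/_)
import Data.Rational as ℚ
open import Data.Product using (∃; _×_; _,_)
open import Relation.Binary.PropositionalEquality using (_≡_)

-- The quaternion algebra B(L,1) over ℚ: an element is given by its
-- coordinates w.r.t. the basis 1, i^L, j^L, k^L.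
record B (L : ℕ) : Set where
  constructor quat
  field
    c1 ci cj ck : ℚ
open B public

_⊕_ : ∀ {L} → B L → B L → B L
quat a b c d ⊕ quat a' b' c' d' = quat (a + a') (b + b') (c + c') (d + d')

_⊙_ : ∀ {L} → ℚ → B L → B L
r ⊙ quat a b c d = quat (r * a) (r * b) (r * c) (r * d)

-- multiplication: (i^L)^2 = -L, (j^L)^2 = 1, k^L = i^L j^L = - j^L i^L
-- (hence (k^L)^2 = L, i k = -L j, k i = L j, j k = i, k j = -i)
_⊗_ : ∀ {L} → B L → B L → B L
_⊗_ {L} (quat a₁ b₁ c₁ d₁) (quat a₂ b₂ c₂ d₂) =
  quat (a₁ * a₂ - l * b₁ * b₂ + c₁ * c₂ + l * d₁ * d₂)
       (a₁ * b₂ + b₁ * a₂ - c₁ * d₂ + d₁ * c₂)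
       (a₁ * c₂ + c₁ * a₂ - l * b₁ * d₂ + l * d₁ * b₂)
       (a₁ * d₂ + d₁ * a₂ + b₁ * c₂ - c₁ * b₂)
  where
  l : ℚ
  l = + L / 1
  _-_ : ℚ → ℚ → ℚ
  x - y = x + (- y)
  infixl 6 _-_

𝟙 iB jB kB : ∀ {L} → B L
𝟙 = quat 1ℚ 0ℚ 0ℚ 0ℚ
iB = quat 0ℚ 1ℚ 0ℚ 0ℚ
jB = quat 0ℚ 0ℚ 1ℚ 0ℚ
kB = quat 0ℚ 0ℚ 0ℚ 1ℚ

ℤ→ℚ : ℤ → ℚ
ℤ→ℚ z = z / 1

e₁ e₂ e₃ e₄ : (L : ℕ) → B L
e₁ L = 𝟙
e₂ L = ½ ⊙ (𝟙 ⊕ jB)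
e₃ L = ½ ⊙ (iB ⊕ kB)
e₄ L = ((+ L / 1) ⊙ jB) ⊕ kB

InR : (L : ℕ) → B L → Set
InR L x = ∃ λ (a₁ : ℤ) → ∃ λ (a₂ : ℤ) → ∃ λ (a₃ : ℤ) → ∃ λ (a₄ : ℤ) →
  x ≡ ((ℤ→ℚ a₁ ⊙ e₁ L) ⊕ (ℤ→ℚ a₂ ⊙ e₂ L)) ⊕ ((ℤ→ℚ a₃ ⊙ e₃ L) ⊕ (ℤ→ℚ a₄ ⊙ e₄ L))

Ψ : (N M : ℕ) → .{{NonZero M}} → B N → B M
Ψ N M (quat a b c d) =
  ((a ⊙ 𝟙) ⊕ (c ⊙ jB)) ⊕ ((b ⊙ Ψi) ⊕ (d ⊙ Ψk))
  where
  p q : ℚ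
  p = ½ * ((+ (M ℕ.+ N)) / M)
  q = ½ * ((+ M ℤ.- + N) / M)
  Ψi Ψk : B M
  Ψi = (p ⊙ iB) ⊕ (q ⊙ kB)
  Ψk = (q ⊙ iB) ⊕ (p ⊙ kB)

module Submission where

-- Write N = k·M.  Then Ψ_N^M is the ℚ-linear map Φ p q that fixes 1 and j
-- and sends i ↦ p i + q k, k ↦ q i + p k, with p = (1+k)/2, q = (1−k)/2.
-- On the generators of R(N) it acts by
--     e₁ ↦ e₁,   e₂ ↦ e₂,   e₃ ↦ e₃,   e₄ ↦ (1−k) e₃ + k e₄,
-- so Ψ(a₁e₁ + a₂e₂ + a₃e₃ + a₄e₄) = a₁e₁ + a₂e₂ + (a₃ + (1−k)a₄) e₃ + k a₄ e₄,
-- whose coordinates are again integers; hence Ψ(R(N)) ⊆ R(M).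

open import Defs
open import Data.Nat as ℕ using (ℕ; NonZero; suc)
open import Data.Nat.Divisibility using (_∣_; divides)
open import Data.Integer as ℤ using (ℤ; +_)
import Data.Integer.Properties as ℤP
open import Data.Integer.Tactic.RingSolver using (solve-∀)
open import Data.Fin using (#_)
open import Data.Vec using (Vec; []; _∷_)
open import Data.Product using (_×_; _,_)
open import Data.Rational using (ℚ; 0ℚ; 1ℚ; ½; _+_; _*_; -_; _-_; _/_; fromℚᵘ)
open import Data.Rational.Properties
  using (toℚᵘ-injective; toℚᵘ-fromℚᵘ; toℚᵘ-homo-+; toℚᵘ-homo-*; toℚᵘ-homo‿-; fromℚᵘ-cong)
open import Data.Rational.Solver using (module +-*-Solver)
open import Data.Rational.Unnormalised as ℚᵘ using (mkℚᵘ; *≡*)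
import Data.Rational.Unnormalised.Properties as ℚᵘP
open import Relation.Binary.PropositionalEquality

open +-*-Solver using (Polynomial; con; var; _:+_; _:*_; :-_; ⟦_⟧; ⟦_⟧↓; prove)

record Sym (n : ℕ) : Set where
  constructor ⟨_,_,_,_⟩
  field s₁ sᵢ sⱼ sₖ : Polynomial n

⟦_⟧B : ∀ {n L} → Sym n → Vec ℚ n → B L
⟦ ⟨ a , b , c , d ⟩ ⟧B ρ = quat (⟦ a ⟧ ρ) (⟦ b ⟧ ρ) (⟦ c ⟧ ρ) (⟦ d ⟧ ρ)

-- Coordinatewise agreement of normal forms; for equal normal forms each
-- component is proved by refl.
_≐_at_ : ∀ {n} → Sym n → Sym n → Vec ℚ n → Set
⟨ a , b , c , d ⟩ ≐ ⟨ a' , b' , c' , d' ⟩ at ρ =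
  (⟦ a ⟧↓ ρ ≡ ⟦ a' ⟧↓ ρ) × (⟦ b ⟧↓ ρ ≡ ⟦ b' ⟧↓ ρ) ×
  (⟦ c ⟧↓ ρ ≡ ⟦ c' ⟧↓ ρ) × (⟦ d ⟧↓ ρ ≡ ⟦ d' ⟧↓ ρ)

quat-cong : ∀ {L} {a b c d a' b' c' d' : ℚ} →
  a ≡ a' → b ≡ b' → c ≡ c' → d ≡ d' → quat {L} a b c d ≡ quat a' b' c' d'
quat-cong refl refl refl refl = refl

byNormalForms : ∀ {n L} (ρ : Vec ℚ n) (s t : Sym n) →
  s ≐ t at ρ → _≡_ {A = B L} (⟦ s ⟧B ρ) (⟦ t ⟧B ρ)
byNormalForms ρ ⟨ a , b , c , d ⟩ ⟨ a' , b' , c' , d' ⟩ (ea , eb , ec , ed) =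
  quat-cong (prove ρ a a' ea) (prove ρ b b' eb) (prove ρ c c' ec) (prove ρ d d' ed)

-- Symbolic counterparts of the vector-space operations and elements of
-- B(L,1) that are used below; their values are definitionally the real ones.
_⊕ˢ_ : ∀ {n} → Sym n → Sym n → Sym n
⟨ a , b , c , d ⟩ ⊕ˢ ⟨ a' , b' , c' , d' ⟩ = ⟨ a :+ a' , b :+ b' , c :+ c' , d :+ d' ⟩

_⊙ˢ_ : ∀ {n} → Polynomial n → Sym n → Sym n
r ⊙ˢ ⟨ a , b , c , d ⟩ = ⟨ r :* a , r :* b , r :* c , r :* d ⟩

𝟙ˢ iˢ jˢ kˢ : ∀ {n} → Sym n
𝟙ˢ = ⟨ con 1ℚ , con 0ℚ , con 0ℚ , con 0ℚ ⟩
iˢ = ⟨ con 0ℚ , con 1ℚ , con 0ℚ , con 0ℚ ⟩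
jˢ = ⟨ con 0ℚ , con 0ℚ , con 1ℚ , con 0ℚ ⟩
kˢ = ⟨ con 0ℚ , con 0ℚ , con 0ℚ , con 1ℚ ⟩

e₃ˢ : ∀ {n} → Sym n
e₃ˢ = con ½ ⊙ˢ (iˢ ⊕ˢ kˢ)

e₄ˢ : ∀ {n} → Polynomial n → Sym n
e₄ˢ ℓ = (ℓ ⊙ˢ jˢ) ⊕ˢ kˢ

Φ : ∀ {N M} → ℚ → ℚ → B N → B M
Φ p q (quat a b c d) =
  ((a ⊙ 𝟙) ⊕ (c ⊙ jB)) ⊕ ((b ⊙ ((p ⊙ iB) ⊕ (q ⊙ kB))) ⊕ (d ⊙ ((q ⊙ iB) ⊕ (p ⊙ kB))))

Φˢ : ∀ {n} → Polynomial n → Polynomial n → Sym n → Sym n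
Φˢ p q ⟨ a , b , c , d ⟩ =
  ((a ⊙ˢ 𝟙ˢ) ⊕ˢ (c ⊙ˢ jˢ)) ⊕ˢ ((b ⊙ˢ ((p ⊙ˢ iˢ) ⊕ˢ (q ⊙ˢ kˢ))) ⊕ˢ (d ⊙ˢ ((q ⊙ˢ iˢ) ⊕ˢ (p ⊙ˢ kˢ))))

Ψ≡Φ : ∀ N M .{{_ : NonZero M}} (x : B N) →
  Ψ N M x ≡ Φ (½ * ((+ (M ℕ.+ N)) / M)) (½ * ((+ M ℤ.- + N) / M)) x
Ψ≡Φ N M (quat a b c d) = refl

Φ-additive : ∀ {N M} p q (x y : B N) → Φ {N} {M} p q (x ⊕ y) ≡ Φ p q x ⊕ Φ p q y
Φ-additive p q (quat a b c d) (quat a' b' c' d') =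
  byNormalForms (a ∷ b ∷ c ∷ d ∷ a' ∷ b' ∷ c' ∷ d' ∷ p ∷ q ∷ [])
    (Φˢ P Q (X ⊕ˢ Y)) (Φˢ P Q X ⊕ˢ Φˢ P Q Y) (refl , refl , refl , refl)
  where
  X Y : Sym 10
  X = ⟨ var (# 0) , var (# 1) , var (# 2) , var (# 3) ⟩
  Y = ⟨ var (# 4) , var (# 5) , var (# 6) , var (# 7) ⟩
  P Q : Polynomial 10
  P = var (# 8)
  Q = var (# 9)

Φ-homogeneous : ∀ {N M} p q r (x : B N) → Φ {N} {M} p q (r ⊙ x) ≡ r ⊙ Φ p q x
Φ-homogeneous p q r (quat a b c d) =
  byNormalForms (a ∷ b ∷ c ∷ d ∷ r ∷ p ∷ q ∷ [])
    (Φˢ P Q (R ⊙ˢ X)) (R ⊙ˢ Φˢ P Q X) (refl , refl , refl , refl)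
  where
  X : Sym 7
  X = ⟨ var (# 0) , var (# 1) , var (# 2) , var (# 3) ⟩
  R P Q : Polynomial 7
  R = var (# 4)
  P = var (# 5)
  Q = var (# 6)

e₄[_] : ∀ {L} → ℚ → B L
e₄[ ℓ ] = (ℓ ⊙ jB) ⊕ kB

combination : ∀ {L} → ℚ → (a₁ a₂ a₃ a₄ : ℚ) → B L
combination {L} ℓ a₁ a₂ a₃ a₄ =
  ((a₁ ⊙ e₁ L) ⊕ (a₂ ⊙ e₂ L)) ⊕ ((a₃ ⊙ e₃ L) ⊕ (a₄ ⊙ e₄[ ℓ ]))

Φ-e₁ : ∀ {N M} p q → Φ p q (e₁ N) ≡ e₁ M
Φ-e₁ p q = byNormalForms (p ∷ q ∷ []) (Φˢ P Q 𝟙ˢ) 𝟙ˢ (refl , refl , refl , refl)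
  where
  P Q : Polynomial 2
  P = var (# 0)
  Q = var (# 1)

Φ-e₂ : ∀ {N M} p q → Φ p q (e₂ N) ≡ e₂ M
Φ-e₂ p q = byNormalForms (p ∷ q ∷ [])
  (Φˢ P Q (con ½ ⊙ˢ (𝟙ˢ ⊕ˢ jˢ))) (con ½ ⊙ˢ (𝟙ˢ ⊕ˢ jˢ)) (refl , refl , refl , refl)
  where
  P Q : Polynomial 2
  P = var (# 0)
  Q = var (# 1)

-- For p = (1+K)/2, q = (1−K)/2: e₃ = (i+k)/2 is fixed (as p + q = 1) and
-- e₄[K·ℓ] ↦ (1−K) e₃ + K e₄[ℓ].
Φ-e₃ : ∀ {N M} K → Φ (½ * (1ℚ + K)) (½ * (1ℚ - K)) (e₃ N) ≡ e₃ M
Φ-e₃ K = byNormalForms (K ∷ [])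
  (Φˢ (con ½ :* (con 1ℚ :+ κ)) (con ½ :* (con 1ℚ :+ :- κ)) e₃ˢ) e₃ˢ
  (refl , refl , refl , refl)
  where
  κ : Polynomial 1
  κ = var (# 0)

Φ-e₄ : ∀ {N M} K ℓ →
  Φ (½ * (1ℚ + K)) (½ * (1ℚ - K)) (e₄[_] {N} (K * ℓ)) ≡ ((1ℚ - K) ⊙ e₃ M) ⊕ (K ⊙ e₄[ ℓ ])
Φ-e₄ K ℓ = byNormalForms (K ∷ ℓ ∷ [])
  (Φˢ (con ½ :* (con 1ℚ :+ κ)) (con ½ :* (con 1ℚ :+ :- κ)) (e₄ˢ (κ :* ℓˢ)))
  (((con 1ℚ :+ :- κ) ⊙ˢ e₃ˢ) ⊕ˢ (κ ⊙ˢ e₄ˢ ℓˢ))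
  (refl , refl , refl , refl)
  where
  κ ℓˢ : Polynomial 2
  κ = var (# 0)
  ℓˢ = var (# 1)

Φ-linear₄ : ∀ {N M} p q (a₁ a₂ a₃ a₄ : ℚ) (x₁ x₂ x₃ x₄ : B N) →
  Φ {N} {M} p q (((a₁ ⊙ x₁) ⊕ (a₂ ⊙ x₂)) ⊕ ((a₃ ⊙ x₃) ⊕ (a₄ ⊙ x₄))) ≡
  ((a₁ ⊙ Φ p q x₁) ⊕ (a₂ ⊙ Φ p q x₂)) ⊕ ((a₃ ⊙ Φ p q x₃) ⊕ (a₄ ⊙ Φ p q x₄))
Φ-linear₄ {N} {M} p q a₁ a₂ a₃ a₄ x₁ x₂ x₃ x₄ = begin
  f (((a₁ ⊙ x₁) ⊕ (a₂ ⊙ x₂)) ⊕ ((a₃ ⊙ x₃) ⊕ (a₄ ⊙ x₄)))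
    ≡⟨ Φ-additive {M = M} p q ((a₁ ⊙ x₁) ⊕ (a₂ ⊙ x₂)) ((a₃ ⊙ x₃) ⊕ (a₄ ⊙ x₄)) ⟩
  f ((a₁ ⊙ x₁) ⊕ (a₂ ⊙ x₂)) ⊕ f ((a₃ ⊙ x₃) ⊕ (a₄ ⊙ x₄))
    ≡⟨ cong₂ _⊕_ (Φ-additive {M = M} p q (a₁ ⊙ x₁) (a₂ ⊙ x₂))
                 (Φ-additive {M = M} p q (a₃ ⊙ x₃) (a₄ ⊙ x₄)) ⟩
  (f (a₁ ⊙ x₁) ⊕ f (a₂ ⊙ x₂)) ⊕ (f (a₃ ⊙ x₃) ⊕ f (a₄ ⊙ x₄))
    ≡⟨ cong₂ _⊕_ (cong₂ _⊕_ (Φ-homogeneous {M = M} p q a₁ x₁) (Φ-homogeneous {M = M} p q a₂ x₂))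
                 (cong₂ _⊕_ (Φ-homogeneous {M = M} p q a₃ x₃) (Φ-homogeneous {M = M} p q a₄ x₄)) ⟩
  ((a₁ ⊙ f x₁) ⊕ (a₂ ⊙ f x₂)) ⊕ ((a₃ ⊙ f x₃) ⊕ (a₄ ⊙ f x₄)) ∎
  where
  open ≡-Reasoning
  f : B N → B M
  f = Φ p q

collect : ∀ {L} (a b c d : ℚ) (x y : B L) →
  (a ⊙ x) ⊕ (b ⊙ ((c ⊙ x) ⊕ (d ⊙ y))) ≡ ((a + b * c) ⊙ x) ⊕ ((b * d) ⊙ y)
collect a b c d (quat x₁ x₂ x₃ x₄) (quat y₁ y₂ y₃ y₄) =
  byNormalForms (a ∷ b ∷ c ∷ d ∷ x₁ ∷ x₂ ∷ x₃ ∷ x₄ ∷ y₁ ∷ y₂ ∷ y₃ ∷ y₄ ∷ [])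
    ((A ⊙ˢ X) ⊕ˢ (B′ ⊙ˢ ((C ⊙ˢ X) ⊕ˢ (D ⊙ˢ Y)))) (((A :+ B′ :* C) ⊙ˢ X) ⊕ˢ ((B′ :* D) ⊙ˢ Y))
    (refl , refl , refl , refl)
  where
  A B′ C D : Polynomial 12
  A = var (# 0)
  B′ = var (# 1)
  C = var (# 2)
  D = var (# 3)
  X Y : Sym 12
  X = ⟨ var (# 4) , var (# 5) , var (# 6) , var (# 7) ⟩
  Y = ⟨ var (# 8) , var (# 9) , var (# 10) , var (# 11) ⟩

Φ-combination : ∀ {N M} K ℓ (a₁ a₂ a₃ a₄ : ℚ) →
  Φ (½ * (1ℚ + K)) (½ * (1ℚ - K)) (combination {N} (K * ℓ) a₁ a₂ a₃ a₄) ≡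
  combination {M} ℓ a₁ a₂ (a₃ + a₄ * (1ℚ - K)) (a₄ * K)
Φ-combination {N} {M} K ℓ a₁ a₂ a₃ a₄ = begin
  f (combination (K * ℓ) a₁ a₂ a₃ a₄)
    ≡⟨ Φ-linear₄ p q a₁ a₂ a₃ a₄ (e₁ N) (e₂ N) (e₃ N) e₄[ K * ℓ ] ⟩
  ((a₁ ⊙ f (e₁ N)) ⊕ (a₂ ⊙ f (e₂ N))) ⊕ ((a₃ ⊙ f (e₃ N)) ⊕ (a₄ ⊙ f e₄[ K * ℓ ]))
    ≡⟨ cong₂ _⊕_ (cong₂ (λ u v → (a₁ ⊙ u) ⊕ (a₂ ⊙ v)) (Φ-e₁ {N} p q) (Φ-e₂ {N} p q))
                 (cong₂ (λ u v → (a₃ ⊙ u) ⊕ (a₄ ⊙ v)) (Φ-e₃ {N} K) (Φ-e₄ {N} K ℓ)) ⟩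
  ((a₁ ⊙ e₁ M) ⊕ (a₂ ⊙ e₂ M)) ⊕ ((a₃ ⊙ e₃ M) ⊕ (a₄ ⊙ (((1ℚ - K) ⊙ e₃ M) ⊕ (K ⊙ e₄[ ℓ ]))))
    ≡⟨ cong (((a₁ ⊙ e₁ M) ⊕ (a₂ ⊙ e₂ M)) ⊕_) (collect a₃ a₄ (1ℚ - K) K (e₃ M) e₄[ ℓ ]) ⟩
  combination ℓ a₁ a₂ (a₃ + a₄ * (1ℚ - K)) (a₄ * K) ∎
  where
  open ≡-Reasoning
  p q : ℚ
  p = ½ * (1ℚ + K)
  q = ½ * (1ℚ - K)
  f : B N → B M
  f = Φ p q

-- fromℚᵘ (normalisation) is a ring homomorphism ℚᵘ → ℚ, since its
-- inverse up to ≃, toℚᵘ, is one.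
fromℚᵘ-homo-+ : ∀ p q → fromℚᵘ (p ℚᵘ.+ q) ≡ fromℚᵘ p + fromℚᵘ q
fromℚᵘ-homo-+ p q = toℚᵘ-injective (ℚᵘP.≃-trans (toℚᵘ-fromℚᵘ _) (ℚᵘP.≃-trans
  (ℚᵘP.+-cong (ℚᵘP.≃-sym (toℚᵘ-fromℚᵘ p)) (ℚᵘP.≃-sym (toℚᵘ-fromℚᵘ q)))
  (ℚᵘP.≃-sym (toℚᵘ-homo-+ (fromℚᵘ p) (fromℚᵘ q)))))

fromℚᵘ-homo-* : ∀ p q → fromℚᵘ (p ℚᵘ.* q) ≡ fromℚᵘ p * fromℚᵘ q
fromℚᵘ-homo-* p q = toℚᵘ-injective (ℚᵘP.≃-trans (toℚᵘ-fromℚᵘ _) (ℚᵘP.≃-trans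
  (ℚᵘP.*-cong (ℚᵘP.≃-sym (toℚᵘ-fromℚᵘ p)) (ℚᵘP.≃-sym (toℚᵘ-fromℚᵘ q)))
  (ℚᵘP.≃-sym (toℚᵘ-homo-* (fromℚᵘ p) (fromℚᵘ q)))))

fromℚᵘ-homo‿- : ∀ p → fromℚᵘ (ℚᵘ.- p) ≡ - fromℚᵘ p
fromℚᵘ-homo‿- p = toℚᵘ-injective (ℚᵘP.≃-trans (toℚᵘ-fromℚᵘ _) (ℚᵘP.≃-trans
  (ℚᵘP.-‿cong (ℚᵘP.≃-sym (toℚᵘ-fromℚᵘ p)))
  (ℚᵘP.≃-sym (toℚᵘ-homo‿- (fromℚᵘ p)))))

-- Hence so is the cast ℤ→ℚ z = fromℚᵘ (z/1).
ℤ→ℚ-+ : ∀ a b → ℤ→ℚ (a ℤ.+ b) ≡ ℤ→ℚ a + ℤ→ℚ b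
ℤ→ℚ-+ a b = trans
  (fromℚᵘ-cong {mkℚᵘ (a ℤ.+ b) 0} {mkℚᵘ a 0 ℚᵘ.+ mkℚᵘ b 0} (*≡* (sum-over-1 a b)))
  (fromℚᵘ-homo-+ (mkℚᵘ a 0) (mkℚᵘ b 0))
  where
  sum-over-1 : ∀ (a b : ℤ) → (a ℤ.+ b) ℤ.* + 1 ≡ (a ℤ.* + 1 ℤ.+ b ℤ.* + 1) ℤ.* + 1
  sum-over-1 = solve-∀

ℤ→ℚ-* : ∀ a b → ℤ→ℚ (a ℤ.* b) ≡ ℤ→ℚ a * ℤ→ℚ b
ℤ→ℚ-* a b = fromℚᵘ-homo-* (mkℚᵘ a 0) (mkℚᵘ b 0)

ℤ→ℚ-- : ∀ a b → ℤ→ℚ (a ℤ.- b) ≡ ℤ→ℚ a - ℤ→ℚ b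
ℤ→ℚ-- a b = trans (ℤ→ℚ-+ a (ℤ.- b)) (cong (λ r → ℤ→ℚ a + r) (fromℚᵘ-homo‿- (mkℚᵘ b 0)))

ℤ→ℚ-shear : ∀ a b c →
  ℤ→ℚ (a ℤ.+ b ℤ.* (+ 1 ℤ.- c)) ≡ ℤ→ℚ a + ℤ→ℚ b * (1ℚ - ℤ→ℚ c)
ℤ→ℚ-shear a b c = begin
  ℤ→ℚ (a ℤ.+ b ℤ.* (+ 1 ℤ.- c))       ≡⟨ ℤ→ℚ-+ a _ ⟩
  ℤ→ℚ a + ℤ→ℚ (b ℤ.* (+ 1 ℤ.- c))     ≡⟨ cong (λ r → ℤ→ℚ a + r) (ℤ→ℚ-* b _) ⟩
  ℤ→ℚ a + ℤ→ℚ b * ℤ→ℚ (+ 1 ℤ.- c)     ≡⟨ cong (λ r → ℤ→ℚ a + ℤ→ℚ b * r) (ℤ→ℚ-- (+ 1) c) ⟩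
  ℤ→ℚ a + ℤ→ℚ b * (1ℚ - ℤ→ℚ c)        ∎
  where open ≡-Reasoning

cancel-/ : ∀ z M .{{_ : NonZero M}} → (z ℤ.* + M) / M ≡ ℤ→ℚ z
cancel-/ z (suc m) = fromℚᵘ-cong {mkℚᵘ (z ℤ.* + suc m) m} {mkℚᵘ z 0} (*≡* (ℤP.*-identityʳ _))

sum-ratio : ∀ k M .{{_ : NonZero M}} → (+ (M ℕ.+ k ℕ.* M)) / M ≡ 1ℚ + ℤ→ℚ (+ k)
sum-ratio k M = begin
  (+ (suc k ℕ.* M)) / M      ≡⟨ cong (_/ M) (ℤP.pos-* (suc k) M) ⟩
  (+ suc k ℤ.* + M) / M      ≡⟨ cancel-/ (+ suc k) M ⟩
  ℤ→ℚ (+ 1 ℤ.+ + k)          ≡⟨ ℤ→ℚ-+ (+ 1) (+ k) ⟩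
  1ℚ + ℤ→ℚ (+ k)             ∎
  where open ≡-Reasoning

difference-ratio : ∀ k M .{{_ : NonZero M}} → (+ M ℤ.- + (k ℕ.* M)) / M ≡ 1ℚ - ℤ→ℚ (+ k)
difference-ratio k M = begin
  (+ M ℤ.- + (k ℕ.* M)) / M       ≡⟨ cong (λ n → (+ M ℤ.- n) / M) (ℤP.pos-* k M) ⟩
  (+ M ℤ.- + k ℤ.* + M) / M       ≡⟨ cong (_/ M) (factor (+ M) (+ k)) ⟩
  ((+ 1 ℤ.- + k) ℤ.* + M) / M     ≡⟨ cancel-/ (+ 1 ℤ.- + k) M ⟩
  ℤ→ℚ (+ 1 ℤ.- + k)               ≡⟨ ℤ→ℚ-- (+ 1) (+ k) ⟩
  1ℚ - ℤ→ℚ (+ k)                  ∎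
  where
  open ≡-Reasoning
  factor : ∀ (m k : ℤ) → m ℤ.- k ℤ.* m ≡ (+ 1 ℤ.- k) ℤ.* m
  factor = solve-∀

level-product : ∀ k M → ℤ→ℚ (+ (k ℕ.* M)) ≡ ℤ→ℚ (+ k) * ℤ→ℚ (+ M)
level-product k M = trans (cong ℤ→ℚ (ℤP.pos-* k M)) (ℤ→ℚ-* (+ k) (+ M))

mainTheorem6 : (N M : ℕ) → .{{_ : NonZero N}} → .{{_ : NonZero M}} →
    M ∣ N → (x : B N) → InR N x → InR M (Ψ N M x)
mainTheorem6 .(k ℕ.* M) M (divides k refl) x (a₁ , a₂ , a₃ , a₄ , refl) =
  a₁ , a₂ , a₃ ℤ.+ a₄ ℤ.* (+ 1 ℤ.- + k) , a₄ ℤ.* + k , (begin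
    Ψ N M x
      ≡⟨ Ψ≡Φ N M x ⟩
    Φ {N} {M} (½ * ((+ (M ℕ.+ N)) / M)) (½ * ((+ M ℤ.- + N) / M)) (combination (ℤ→ℚ (+ N)) A₁ A₂ A₃ A₄)
      ≡⟨ cong₂ (λ u v → Φ {N} {M} (½ * u) (½ * v) x) (sum-ratio k M) (difference-ratio k M) ⟩
    Φ {N} {M} (½ * (1ℚ + K)) (½ * (1ℚ - K)) (combination (ℤ→ℚ (+ N)) A₁ A₂ A₃ A₄)
      ≡⟨ cong (λ n → Φ {N} {M} (½ * (1ℚ + K)) (½ * (1ℚ - K)) (combination n A₁ A₂ A₃ A₄)) (level-product k M) ⟩
    Φ {N} {M} (½ * (1ℚ + K)) (½ * (1ℚ - K)) (combination {N} (K * ℓ) A₁ A₂ A₃ A₄)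
      ≡⟨ Φ-combination {N} {M} K ℓ A₁ A₂ A₃ A₄ ⟩
    combination {M} ℓ A₁ A₂ (A₃ + A₄ * (1ℚ - K)) (A₄ * K)
      ≡⟨ cong₂ (combination ℓ A₁ A₂) (sym (ℤ→ℚ-shear a₃ a₄ (+ k))) (sym (ℤ→ℚ-* a₄ (+ k))) ⟩
    combination {M} ℓ A₁ A₂ (ℤ→ℚ (a₃ ℤ.+ a₄ ℤ.* (+ 1 ℤ.- + k))) (ℤ→ℚ (a₄ ℤ.* + k)) ∎)
  where
  open ≡-Reasoning
  N : ℕ
  N = k ℕ.* M
  K ℓ A₁ A₂ A₃ A₄ : ℚ
  K = ℤ→ℚ (+ k)
  ℓ = ℤ→ℚ (+ M)
  A₁ = ℤ→ℚ a₁
  A₂ = ℤ→ℚ a₂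
  A₃ = ℤ→ℚ a₃
  A₄ = ℤ→ℚ a₄
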